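{- Let $G=(V,E)$ be a graph with arboricity $\alpha$ containing $T$ triangles, and let $\tau>0$. Then $G$ contains at least $\left(1-\frac{3\alpha}{\tau}\right)T$ $\tau$-light triangles.
   Context: The arboricity of a graph is the minimum number of forests into which its edge set can be partitioned. For an edge $e$, let $T_e$ denote the number of triangles of $G$ containing $e$. An edge $e$ is $\tau$-heavy if $T_e>\tau$, and $\tau$-light if $T_e\le\tau$. A triangle is $\tau$-heavy if all three of its edges are $\tau$-heavy; otherwise it is $\tau$-light.
   Formalization: The threshold τ ranges only over the positive rationals. -}

module Defs where

open import Data.Bool using (Bool; true; false; _∧_; _∨_; T)
open import Data.Nat as ℕ using (ℕ; _<ᵇ_)
open import Data.Fin using (Fin; toℕ)
open import Data.List using (List; []; _∷_; _++_; [_]; length; filterᵇ; concatMap; allFin)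
open import Data.List.Relation.Unary.Unique.Propositional using (Unique)
open import Data.Product using (Σ; _×_; ∃)
open import Data.Unit using (⊤)
open import Data.Empty using (⊥)
open import Data.Integer using (+_)
open import Data.Rational using (ℚ; _/_; _≤ᵇ_)
open import Relation.Binary.PropositionalEquality using (_≡_)
open import Relation.Nullary using (¬_)

record Graph : Set where
  field
    n      : ℕ
    adj    : Fin n → Fin n → Bool
    sym    : ∀ u v → adj u v ≡ adj v u
    irrefl : ∀ v → adj v v ≡ false
open Graph public

Walk : {A : Set} → (A → A → Set) → List A → Set
Walk R []            = ⊤
Walk R (x ∷ [])      = ⊤
Walk R (x ∷ y ∷ xs)  = R x y × Walk R (y ∷ xs)

Cycle : {A : Set} → (A → A → Set) → List A → Set
Cycle R []       = ⊥
Cycle R (x ∷ xs) = (3 ℕ.≤ length (x ∷ xs)) × Unique (x ∷ xs) × Walk R ((x ∷ xs) ++ [ x ])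

-- An assignment of each edge to one of k classes (symmetric on edges),
-- i.e. a partition of the edge set into k parts.
record EdgePartition (G : Graph) (k : ℕ) : Set where
  field
    colour    : Fin (n G) → Fin (n G) → Fin k
    colourSym : ∀ u v → T (adj G u v) → colour u v ≡ colour v u

ClassEdge : {G : Graph} {k : ℕ} → EdgePartition G k → Fin k → Fin (n G) → Fin (n G) → Set
ClassEdge {G} P i u v = T (adj G u v) × (EdgePartition.colour P u v ≡ i)

ForestPartition : Graph → ℕ → Set
ForestPartition G k =
  Σ (EdgePartition G k) λ P → ∀ (i : Fin k) (vs : List (Fin (n G))) → ¬ Cycle (ClassEdge P i) vs

IsArboricity : Graph → ℕ → Set
IsArboricity G α = ForestPartition G α × (∀ k → k ℕ.< α → ¬ ForestPartition G k)

-- T_e for e = {u,v}: number of vertices w adjacent to both u and v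
-- (the number of triangles containing e, when uv is an edge).
triCount : (G : Graph) → Fin (n G) → Fin (n G) → ℕ
triCount G u v = length (filterᵇ (λ w → adj G u w ∧ adj G v w) (allFin (n G)))

triangles : (G : Graph) → List (Fin (n G) × Fin (n G) × Fin (n G))
triangles G =
  filterᵇ isTri
    (concatMap (λ a → concatMap (λ b → Data.List.map (λ c → a Data.Product., b Data.Product., c)
       (allFin (n G))) (allFin (n G))) (allFin (n G)))
  where
    import Data.List
    import Data.Product
    isTri : Fin (n G) × Fin (n G) × Fin (n G) → Bool
    isTri (a Data.Product., b Data.Product., c) =
      (toℕ a <ᵇ toℕ b) ∧ (toℕ b <ᵇ toℕ c) ∧ adj G a b ∧ adj G b c ∧ adj G a c

lightEdge : (G : Graph) → ℚ → Fin (n G) → Fin (n G) → Bool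
lightEdge G τ u v = ((+ triCount G u v) / 1) ≤ᵇ τ

-- A triangle is τ-light iff it is not τ-heavy, i.e. at least one edge is τ-light.
lightTriangles : (G : Graph) → ℚ → List (Fin (n G) × Fin (n G) × Fin (n G))
lightTriangles G τ = filterᵇ isLight (triangles G)
  where
    isLight : Fin (n G) × Fin (n G) × Fin (n G) → Bool
    isLight (a Data.Product., b Data.Product., c) =
      lightEdge G τ a b ∨ lightEdge G τ b c ∨ lightEdge G τ a c
      where import Data.Product

{-# OPTIONS --safe #-}
module Submission where

-- Orient each of the α forests by repeatedly deleting a leaf and pointing it at its unique
-- remaining neighbour: every vertex gets at most α out-arcs, and every edge is oriented.
-- Write τ = p/q and count triangles as ordered triples: 6T in all, 6H heavy.  An ordered heavy
-- triple (x, y, z) has an arc between x and y, so by symmetry 6H ≤ 2·#{heavy (x, y, z) with x → y}.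
-- Charge such a triple to the edge xz, which is heavy, so p < q·T_xz: for fixed x and z, p times
-- the number of these triples is at most q·T_xz·outdeg(x) ≤ α·q·T_xz, and summing T_xz over the
-- ordered edges xz gives 6T.  Hence p·6H ≤ 2αq·6T, i.e. H ≤ 2αT/τ, and the light triangles
-- number T − H ≥ (1 − 3α/τ)T.

open import Defs
  using (Graph; Walk; Cycle; EdgePartition; ClassEdge; ForestPartition; IsArboricity
        ; triCount; triangles; lightEdge; lightTriangles)

module Combinatorics where

  open import Data.Bool using (Bool; true; false; _∧_; _∨_; not; T)
  open import Data.Bool.Properties using (∧-assoc; ∧-comm; ∨-assoc; ∨-comm; T?; T-≡; T-not-≡; T-∧; T-∨; ¬-not)
  open import Data.Fin using (Fin; zero; suc; toℕ)
  open import Data.Fin.Properties using (_≟_; toℕ-injective; any?)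
  open import Data.Fin.Subset using (Subset; _∈_; _∉_; ⊤; _-_; ∣_∣)
  open import Data.Fin.Subset.Properties using (_∈?_; ∈⊤; nonempty?; x∈p⇒∣p-x∣<∣p∣; x∈p∧x≢y⇒x∈p-y)
  open import Data.List
    using (List; []; _∷_; _++_; _∷ʳ_; [_]; head; length; filterᵇ; concatMap; tabulate; map; allFin)
  open import Data.List.Properties using (length-++; filter-++; map-tabulate; length-++-≤ʳ; ++-assoc)
  open import Data.List.Membership.Propositional using () renaming (_∈_ to _∈ˡ_; _∉_ to _∉ˡ_)
  open import Data.List.Membership.Propositional.Properties using (∈-∃++)
  import Data.List.Relation.Unary.All as All
  import Data.List.Relation.Unary.All.Properties as All
  open import Data.List.Relation.Unary.All.Properties using (¬Any⇒All¬)
  open import Data.List.Relation.Unary.AllPairs using ([]; _∷_)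
  open import Data.List.Relation.Unary.Any using (here; there)
  open import Data.List.Relation.Unary.Unique.Propositional using (Unique)
  open import Data.Maybe using (Maybe; just; nothing)
  open import Data.Maybe.Properties using (≡-dec)
  open import Data.Nat using (ℕ; zero; suc; _+_; _*_; _≤_; _<_; z≤n; s≤s; _<ᵇ_)
  open import Data.Nat.Induction using (<-wellFounded)
  open import Data.Nat.Properties
    using ( +-identityʳ; +-suc; +-mono-≤; m≤m+n; m≤n+m; *-identityˡ; *-identityʳ; *-zeroʳ; *-distribˡ-+
          ; *-monoˡ-≤; *-monoʳ-≤; *-cancelˡ-≤; ≤-trans; ≤-reflexive; <-trans; <⇒≤; ≤⇒≯; <-cmp
          ; <⇒<ᵇ; <ᵇ⇒<; +-*-semiring; module ≤-Reasoning)
  open import Data.Nat.Tactic.RingSolver using (solve-∀)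
  open import Data.Product using (_×_; _,_; ∃; proj₁; proj₂)
  open import Data.Sum using (_⊎_; inj₁; inj₂)
  import Data.Sum as Sum
  open import Data.Unit using (tt)
  open import Data.Vec.Functional using (updateAt)
  open import Data.Vec.Functional.Properties using (updateAt-updates; updateAt-minimal)
  open import Function using (_∘_; id; const)
  open import Function.Bundles using (Equivalence)
  open import Induction.WellFounded using (Acc; acc)
  open import Relation.Binary.Definitions using (tri<; tri≈; tri>)
  open import Relation.Binary.PropositionalEquality
    using (_≡_; _≢_; refl; sym; trans; cong; cong₂; subst; module ≡-Reasoning)
  open import Relation.Nullary using (¬_; Dec; yes; no; does; contradiction)
  open import Relation.Nullary.Decidable using (_×-dec_; ¬?; decidable-stable; dec-true)
  open import Algebra.Definitions {A = Bool} _≡_ using (Commutative; Associative)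
  open import Algebra.Properties.Semiring.Sum +-*-semiring
    using (sum; ∑-comm; ∑-distrib-+; sum-cong-≗; *-distribˡ-sum; sum-replicate-zero)

  𝟙 : Bool → ℕ
  𝟙 true  = 1
  𝟙 false = 0

  𝟙-∧ : ∀ a b → 𝟙 (a ∧ b) ≡ 𝟙 a * 𝟙 b
  𝟙-∧ true  b = sym (+-identityʳ (𝟙 b))
  𝟙-∧ false b = refl

  𝟙-T : ∀ {b} → T b → 𝟙 b ≡ 1
  𝟙-T {true} _ = refl

  𝟙≤𝟙* : ∀ b {m} → (T b → 1 ≤ m) → 𝟙 b ≤ 𝟙 b * m
  𝟙≤𝟙* false     _   = z≤n
  𝟙≤𝟙* true  {m} 1≤m = ≤-trans (1≤m _) (≤-reflexive (sym (+-identityʳ m)))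

  𝟙-weighted-≤ : ∀ b m {p c} → (T b → p ≤ c) → p * (𝟙 b * m) ≤ c * m
  𝟙-weighted-≤ false m {p} _   = ≤-trans (≤-reflexive (*-zeroʳ p)) z≤n
  𝟙-weighted-≤ true  m {p} p≤c = ≤-trans (≤-reflexive (cong (p *_) (+-identityʳ m))) (*-monoˡ-≤ m (p≤c _))

  sum-mono-≤ : ∀ {n} {f g : Fin n → ℕ} → (∀ i → f i ≤ g i) → sum f ≤ sum g
  sum-mono-≤ {zero}  f≤g = z≤n
  sum-mono-≤ {suc n} f≤g = +-mono-≤ (f≤g zero) (sum-mono-≤ (f≤g ∘ suc))

  term≤sum : ∀ {n} (f : Fin n → ℕ) i → f i ≤ sum f
  term≤sum f zero    = m≤m+n _ _
  term≤sum f (suc i) = ≤-trans (term≤sum (f ∘ suc) i) (m≤n+m _ _)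

  module _ {n : ℕ} where

    ∑³ : (Fin n → Fin n → Fin n → ℕ) → ℕ
    ∑³ f = sum λ x → sum λ y → sum λ z → f x y z

    ∑³-cong : ∀ {f g} → (∀ x y z → f x y z ≡ g x y z) → ∑³ f ≡ ∑³ g
    ∑³-cong f≡g = sum-cong-≗ λ x → sum-cong-≗ λ y → sum-cong-≗ (f≡g x y)

    ∑³-mono-≤ : ∀ {f g} → (∀ x y z → f x y z ≤ g x y z) → ∑³ f ≤ ∑³ g
    ∑³-mono-≤ f≤g = sum-mono-≤ λ x → sum-mono-≤ λ y → sum-mono-≤ (f≤g x y)

    ∑³-distrib-+ : ∀ f g → ∑³ (λ x y z → f x y z + g x y z) ≡ ∑³ f + ∑³ g
    ∑³-distrib-+ f g = begin
      ∑³ (λ x y z → f x y z + g x y z)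
        ≡⟨ sum-cong-≗ (λ x → sum-cong-≗ λ y → ∑-distrib-+ (f x y) (g x y)) ⟩
      sum (λ x → sum λ y → sum (f x y) + sum (g x y))
        ≡⟨ sum-cong-≗ (λ x → ∑-distrib-+ (λ y → sum (f x y)) (λ y → sum (g x y))) ⟩
      sum (λ x → sum (λ y → sum (f x y)) + sum (λ y → sum (g x y)))
        ≡⟨ ∑-distrib-+ (λ x → sum λ y → sum (f x y)) (λ x → sum λ y → sum (g x y)) ⟩
      ∑³ f + ∑³ g ∎
      where open ≡-Reasoning

    *-distribˡ-sum² : ∀ c (f : Fin n → Fin n → ℕ) →
      c * sum (λ x → sum (f x)) ≡ sum (λ x → sum (λ y → c * f x y))
    *-distribˡ-sum² c f =
      trans (*-distribˡ-sum c (λ x → sum (f x))) (sum-cong-≗ λ x → *-distribˡ-sum c (f x))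

    ∑³-swap₁₂ : ∀ f → ∑³ f ≡ ∑³ (λ x y z → f y x z)
    ∑³-swap₁₂ f = ∑-comm (λ x y → sum (f x y))

    ∑³-swap₂₃ : ∀ f → ∑³ f ≡ ∑³ (λ x y z → f x z y)
    ∑³-swap₂₃ f = sum-cong-≗ λ x → ∑-comm (f x)

  count : {A : Set} → (A → Bool) → List A → ℕ
  count p = length ∘ filterᵇ p

  module _ {A : Set} where

    count-∷ : ∀ (p : A → Bool) x xs → count p (x ∷ xs) ≡ 𝟙 (p x) + count p xs
    count-∷ p x xs with p x
    ... | true  = refl
    ... | false = refl

    count-++ : ∀ (p : A → Bool) xs ys → count p (xs ++ ys) ≡ count p xs + count p ys
    count-++ p xs ys = trans (cong length (filter-++ _ xs ys)) (length-++ (filterᵇ p xs))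

    count-filterᵇ : ∀ (p q : A → Bool) xs → count q (filterᵇ p xs) ≡ count (λ x → p x ∧ q x) xs
    count-filterᵇ p q [] = refl
    count-filterᵇ p q (x ∷ xs) = trans head-step (sym (count-∷ (λ x → p x ∧ q x) x xs))
      where
      head-step : count q (filterᵇ p (x ∷ xs)) ≡ 𝟙 (p x ∧ q x) + count (λ x → p x ∧ q x) xs
      head-step with p x
      ... | true  = trans (count-∷ q x _) (cong (𝟙 (q x) +_) (count-filterᵇ p q xs))
      ... | false = count-filterᵇ p q xs

    count+count-not : ∀ (p : A → Bool) xs → count p xs + count (not ∘ p) xs ≡ length xs
    count+count-not p [] = refl
    count+count-not p (x ∷ xs) with p x
    ... | true  = cong suc (count+count-not p xs)
    ... | false = trans (+-suc _ _) (cong suc (count+count-not p xs))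

    count-tabulate : ∀ (p : A → Bool) {n} (f : Fin n → A) → count p (tabulate f) ≡ sum (λ i → 𝟙 (p (f i)))
    count-tabulate p {zero}  f = refl
    count-tabulate p {suc n} f =
      trans (count-∷ p (f zero) _) (cong (𝟙 (p (f zero)) +_) (count-tabulate p (f ∘ suc)))

    count-concatMap-tabulate : ∀ {B : Set} (p : A → Bool) (g : B → List A) {n} (f : Fin n → B) →
      count p (concatMap g (tabulate f)) ≡ sum (λ i → count p (g (f i)))
    count-concatMap-tabulate p g {zero}  f = refl
    count-concatMap-tabulate p g {suc n} f =
      trans (count-++ p (g (f zero)) _) (cong (count p (g (f zero)) +_) (count-concatMap-tabulate p g (f ∘ suc)))

  triples : ∀ n → List (Fin n × Fin n × Fin n)
  triples n = concatMap (λ a → concatMap (λ b → map (λ c → a , b , c) (allFin n)) (allFin n)) (allFin n)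

  count-triples : ∀ {n} (p : Fin n × Fin n × Fin n → Bool) →
    count p (triples n) ≡ ∑³ (λ x y z → 𝟙 (p (x , y , z)))
  count-triples {n} p =
    trans (count-concatMap-tabulate p (λ x → concatMap (row x) (allFin n)) id) (sum-cong-≗ λ x →
    trans (count-concatMap-tabulate p (row x) id) (sum-cong-≗ λ y →
    trans (cong (count p) (map-tabulate id (λ z → x , y , z))) (count-tabulate p (λ z → x , y , z))))
    where
    row : Fin n → Fin n → List (Fin n × Fin n × Fin n)
    row x y = map (λ z → x , y , z) (allFin n)

  ascending : ℕ → ℕ → ℕ → Bool
  ascending a b c = (a <ᵇ b) ∧ (b <ᵇ c)

  ascendingOrders : ℕ → ℕ → ℕ → ℕ
  ascendingOrders a b c = 𝟙 (ascending a b c) + 𝟙 (ascending a c b) + 𝟙 (ascending b a c)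
                        + 𝟙 (ascending b c a) + 𝟙 (ascending c a b) + 𝟙 (ascending c b a)

  ascendingOrders-swap₁₂ : ∀ a b c → ascendingOrders a b c ≡ ascendingOrders b a c
  ascendingOrders-swap₁₂ a b c = rearrange (𝟙 (ascending a b c)) (𝟙 (ascending a c b)) (𝟙 (ascending b a c))
                                            (𝟙 (ascending b c a)) (𝟙 (ascending c a b)) (𝟙 (ascending c b a))
    where
    rearrange : ∀ u₁ u₂ u₃ u₄ u₅ u₆ → u₁ + u₂ + u₃ + u₄ + u₅ + u₆ ≡ u₃ + u₄ + u₁ + u₂ + u₆ + u₅
    rearrange = solve-∀

  ascendingOrders-swap₂₃ : ∀ a b c → ascendingOrders a b c ≡ ascendingOrders a c b
  ascendingOrders-swap₂₃ a b c = rearrange (𝟙 (ascending a b c)) (𝟙 (ascending a c b)) (𝟙 (ascending b a c))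
                                            (𝟙 (ascending b c a)) (𝟙 (ascending c a b)) (𝟙 (ascending c b a))
    where
    rearrange : ∀ u₁ u₂ u₃ u₄ u₅ u₆ → u₁ + u₂ + u₃ + u₄ + u₅ + u₆ ≡ u₂ + u₁ + u₅ + u₆ + u₃ + u₄
    rearrange = solve-∀

  <⇒<ᵇ≡true : ∀ {a b} → a < b → (a <ᵇ b) ≡ true
  <⇒<ᵇ≡true a<b = Equivalence.to T-≡ (<⇒<ᵇ a<b)

  ≥⇒<ᵇ≡false : ∀ {a b} → b ≤ a → (a <ᵇ b) ≡ false
  ≥⇒<ᵇ≡false {a} {b} b≤a = ¬-not (≤⇒≯ b≤a ∘ <ᵇ⇒< a b ∘ Equivalence.from T-≡)

  ascendingOrders-sorted : ∀ {a b c} → a < b → b < c → ascendingOrders a b c ≡ 1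
  ascendingOrders-sorted a<b b<c
    rewrite <⇒<ᵇ≡true a<b | <⇒<ᵇ≡true b<c | <⇒<ᵇ≡true (<-trans a<b b<c)
          | ≥⇒<ᵇ≡false (<⇒≤ a<b) | ≥⇒<ᵇ≡false (<⇒≤ b<c) | ≥⇒<ᵇ≡false (<⇒≤ (<-trans a<b b<c)) = refl

  ascendingOrders-distinct-< : ∀ {a b c} → a < b → b ≢ c → a ≢ c → ascendingOrders a b c ≡ 1
  ascendingOrders-distinct-< {a} {b} {c} a<b b≢c a≢c with <-cmp b c | <-cmp a c
  ... | tri< b<c _ _ | _            = ascendingOrders-sorted a<b b<c
  ... | tri≈ _ b≡c _ | _            = contradiction b≡c b≢c
  ... | tri> _ _ c<b | tri< a<c _ _ = trans (ascendingOrders-swap₂₃ a b c) (ascendingOrders-sorted a<c c<b)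
  ... | tri> _ _ _   | tri≈ _ a≡c _ = contradiction a≡c a≢c
  ... | tri> _ _ _   | tri> _ _ c<a =
    trans (ascendingOrders-swap₂₃ a b c) (trans (ascendingOrders-swap₁₂ a c b) (ascendingOrders-sorted c<a a<b))

  ascendingOrders-distinct : ∀ {a b c} → a ≢ b → b ≢ c → a ≢ c → ascendingOrders a b c ≡ 1
  ascendingOrders-distinct {a} {b} {c} a≢b b≢c a≢c with <-cmp a b
  ... | tri< a<b _ _ = ascendingOrders-distinct-< a<b b≢c a≢c
  ... | tri≈ _ a≡b _ = contradiction a≡b a≢b
  ... | tri> _ _ b<a = trans (ascendingOrders-swap₁₂ a b c) (ascendingOrders-distinct-< b<a a≢c b≢c)

  ascendingᶠ : ∀ {n} → Fin n → Fin n → Fin n → Bool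
  ascendingᶠ x y z = ascending (toℕ x) (toℕ y) (toℕ z)

  module _ {n : ℕ} (f : Fin n → Fin n → Fin n → ℕ)
           (f-swap₁₂ : ∀ x y z → f x y z ≡ f y x z) (f-swap₂₃ : ∀ x y z → f x y z ≡ f x z y)
           (f-diagonal : ∀ x z → f x x z ≡ 0) where

    private
      ∑³-on : (Fin n → Fin n → Fin n → Bool) → ℕ
      ∑³-on g = ∑³ (λ x y z → 𝟙 (g x y z) * f x y z)

      ∑³-on-swap₁₂ : ∀ g → ∑³-on g ≡ ∑³-on (λ x y z → g y x z)
      ∑³-on-swap₁₂ g = trans (∑³-swap₁₂ (λ x y z → 𝟙 (g x y z) * f x y z))
        (∑³-cong λ x y z → cong (𝟙 (g y x z) *_) (sym (f-swap₁₂ x y z)))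

      ∑³-on-swap₂₃ : ∀ g → ∑³-on g ≡ ∑³-on (λ x y z → g x z y)
      ∑³-on-swap₂₃ g = trans (∑³-swap₂₃ (λ x y z → 𝟙 (g x y z) * f x y z))
        (∑³-cong λ x y z → cong (𝟙 (g x z y) *_) (sym (f-swap₂₃ x y z)))

      ∑³-on-+⁶ : ∀ g₁ g₂ g₃ g₄ g₅ g₆ →
        ∑³ (λ x y z → (𝟙 (g₁ x y z) + 𝟙 (g₂ x y z) + 𝟙 (g₃ x y z)
                     + 𝟙 (g₄ x y z) + 𝟙 (g₅ x y z) + 𝟙 (g₆ x y z)) * f x y z)
        ≡ ∑³-on g₁ + ∑³-on g₂ + ∑³-on g₃ + ∑³-on g₄ + ∑³-on g₅ + ∑³-on g₆
      ∑³-on-+⁶ g₁ g₂ g₃ g₄ g₅ g₆ =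
        trans (∑³-cong λ x y z → distribute (𝟙 (g₁ x y z)) (𝟙 (g₂ x y z)) (𝟙 (g₃ x y z))
                                            (𝟙 (g₄ x y z)) (𝟙 (g₅ x y z)) (𝟙 (g₆ x y z)) (f x y z)) (
        trans (∑³-distrib-+ _ (term g₆)) (cong (_+ ∑³-on g₆) (
        trans (∑³-distrib-+ _ (term g₅)) (cong (_+ ∑³-on g₅) (
        trans (∑³-distrib-+ _ (term g₄)) (cong (_+ ∑³-on g₄) (
        trans (∑³-distrib-+ _ (term g₃)) (cong (_+ ∑³-on g₃) (∑³-distrib-+ (term g₁) (term g₂))))))))))
        where
        distribute : ∀ u₁ u₂ u₃ u₄ u₅ u₆ v →
          (u₁ + u₂ + u₃ + u₄ + u₅ + u₆) * v ≡ u₁ * v + u₂ * v + u₃ * v + u₄ * v + u₅ * v + u₆ * v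
        distribute = solve-∀
        term : (Fin n → Fin n → Fin n → Bool) → Fin n → Fin n → Fin n → ℕ
        term g x y z = 𝟙 (g x y z) * f x y z

      vanishing⇒≡* : ∀ {m} k → m ≡ 0 → m ≡ k * m
      vanishing⇒≡* k refl = sym (*-zeroʳ k)

      f≡ascendingOrders*f : ∀ x y z → f x y z ≡ ascendingOrders (toℕ x) (toℕ y) (toℕ z) * f x y z
      f≡ascendingOrders*f x y z with x ≟ y | y ≟ z | x ≟ z
      ... | yes refl | _        | _        = vanishing⇒≡* (ascendingOrders (toℕ x) (toℕ x) (toℕ z)) (f-diagonal x z)
      ... | no _     | yes refl | _        = vanishing⇒≡* (ascendingOrders (toℕ x) (toℕ y) (toℕ y))
        (trans (f-swap₁₂ x y y) (trans (f-swap₂₃ y x y) (f-diagonal y x)))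
      ... | no _     | no _     | yes refl = vanishing⇒≡* (ascendingOrders (toℕ x) (toℕ y) (toℕ x))
        (trans (f-swap₂₃ x y x) (f-diagonal x y))
      ... | no x≢y   | no y≢z   | no x≢z   = sym (trans
        (cong (_* f x y z)
          (ascendingOrders-distinct (x≢y ∘ toℕ-injective) (y≢z ∘ toℕ-injective) (x≢z ∘ toℕ-injective)))
        (*-identityˡ (f x y z)))

    ∑³-symmetric : ∑³ f ≡ 6 * ∑³ (λ x y z → 𝟙 (ascendingᶠ x y z) * f x y z)
    ∑³-symmetric = begin
      ∑³ f
        ≡⟨ ∑³-cong f≡ascendingOrders*f ⟩
      ∑³ (λ x y z → ascendingOrders (toℕ x) (toℕ y) (toℕ z) * f x y z)
        ≡⟨ ∑³-on-+⁶ ascendingᶠ (λ x y z → ascendingᶠ x z y) (λ x y z → ascendingᶠ y x z)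
                    (λ x y z → ascendingᶠ y z x) (λ x y z → ascendingᶠ z x y) (λ x y z → ascendingᶠ z y x) ⟩
      S + ∑³-on (λ x y z → ascendingᶠ x z y) + ∑³-on (λ x y z → ascendingᶠ y x z)
        + ∑³-on (λ x y z → ascendingᶠ y z x) + ∑³-on (λ x y z → ascendingᶠ z x y)
        + ∑³-on (λ x y z → ascendingᶠ z y x)
        ≡⟨ sym (cong₂ _+_ (cong₂ _+_ (cong₂ _+_ (cong₂ _+_ (cong (S +_) S≡S₂) S≡S₃) S≡S₄) S≡S₅) S≡S₆) ⟩
      S + S + S + S + S + S
        ≡⟨ six-times S ⟩
      6 * S ∎
      where
      open ≡-Reasoning
      S : ℕ
      S = ∑³-on ascendingᶠ
      six-times : ∀ s → s + s + s + s + s + s ≡ 6 * s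
      six-times = solve-∀
      S≡S₂ : S ≡ ∑³-on (λ x y z → ascendingᶠ x z y)
      S≡S₂ = ∑³-on-swap₂₃ ascendingᶠ
      S≡S₃ : S ≡ ∑³-on (λ x y z → ascendingᶠ y x z)
      S≡S₃ = ∑³-on-swap₁₂ ascendingᶠ
      S≡S₄ : S ≡ ∑³-on (λ x y z → ascendingᶠ y z x)
      S≡S₄ = trans S≡S₂ (∑³-on-swap₁₂ (λ x y z → ascendingᶠ x z y))
      S≡S₅ : S ≡ ∑³-on (λ x y z → ascendingᶠ z x y)
      S≡S₅ = trans S≡S₃ (∑³-on-swap₂₃ (λ x y z → ascendingᶠ y x z))
      S≡S₆ : S ≡ ∑³-on (λ x y z → ascendingᶠ z y x)
      S≡S₆ = trans S≡S₅ (∑³-on-swap₁₂ (λ x y z → ascendingᶠ z x y))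

  module _ {A : Set} {R : A → A → Set} where

    Walk-++⁻ˡ : ∀ xs {ys} → Walk R (xs ++ ys) → Walk R xs
    Walk-++⁻ˡ []           walk          = tt
    Walk-++⁻ˡ (x ∷ [])     walk          = tt
    Walk-++⁻ˡ (x ∷ y ∷ xs) (xRy , walk) = xRy , Walk-++⁻ˡ (y ∷ xs) walk

    Walk-∷ʳ : ∀ xs {a b} → Walk R (xs ∷ʳ a) → R a b → Walk R (xs ∷ʳ a ∷ʳ b)
    Walk-∷ʳ []           walk          aRb = aRb , tt
    Walk-∷ʳ (x ∷ [])     (xRa , _)     aRb = xRa , aRb , tt
    Walk-∷ʳ (x ∷ y ∷ xs) (xRy , walk) aRb = xRy , Walk-∷ʳ (y ∷ xs) walk aRb

  Unique-++⁻ˡ : ∀ {A : Set} (xs : List A) {ys} → Unique (xs ++ ys) → Unique xs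
  Unique-++⁻ˡ []       _            = []
  Unique-++⁻ˡ (x ∷ xs) (x∉ ∷ uniq) = All.++⁻ˡ xs x∉ ∷ Unique-++⁻ˡ xs uniq

  module ForestOrientation {n : ℕ} {R : Fin n → Fin n → Set}
    (R? : ∀ u v → Dec (R u v)) (R-sym : ∀ {u v} → R u v → R v u) (R-irrefl : ∀ {u} → ¬ R u u)
    (acyclic : ∀ vs → ¬ Cycle R vs) where

    private
      non-backtracking-step-is-fresh : ∀ {x rest y} → Unique (x ∷ rest) → Walk R (x ∷ rest) → R x y →
        head rest ≢ just y → y ∉ˡ x ∷ rest
      non-backtracking-step-is-fresh {y = y} uniq walk xRy y≢prev y∈path with ∈-∃++ y∈path
      ... | []               , zs , refl = R-irrefl xRy
      ... | _ ∷ []           , zs , refl = y≢prev refl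
      ... | ys@(_ ∷ _ ∷ ws) , zs , refl = acyclic (ys ∷ʳ y)
        ( s≤s (s≤s (length-++-≤ʳ [ y ] {ws}))
        , Unique-++⁻ˡ (ys ∷ʳ y) (subst Unique (sym (++-assoc ys [ y ] zs)) uniq)
        , Walk-∷ʳ ys (Walk-++⁻ˡ (ys ∷ʳ y) (subst (Walk R) (sym (++-assoc ys [ y ] zs)) walk)) (R-sym xRy))

    AtMostOneNeighbourIn : Subset n → Fin n → Set
    AtMostOneNeighbourIn S x = ∃ λ (m : Maybe (Fin n)) → ∀ {z} → z ∈ S → R x z → m ≡ just z

    private
      -- The walk is stored newest vertex first.  It never revisits a vertex (that would close a
      -- cycle), and U, which contains every unvisited vertex, loses a vertex at each step.
      walk-to-leaf : ∀ {S} x rest (U : Subset n) → Acc _<_ ∣ U ∣ → (∀ {v} → v ∉ U → v ∈ˡ x ∷ rest) →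
        Unique (x ∷ rest) → Walk R (x ∷ rest) → x ∈ S → ∃ λ ℓ → ℓ ∈ S × AtMostOneNeighbourIn S ℓ
      walk-to-leaf {S} x rest U (acc smaller) covered uniq walk x∈S
        with any? (λ z → z ∈? S ×-dec R? x z ×-dec ¬? (≡-dec _≟_ (head rest) (just z)))
      ... | no no-step = x , x∈S , head rest , λ {z} z∈S xRz →
        decidable-stable (≡-dec _≟_ (head rest) (just z)) (λ z≢prev → no-step (z , z∈S , xRz , z≢prev))
      ... | yes (y , y∈S , xRy , y≢prev) =
        walk-to-leaf y (x ∷ rest) (U - y) (smaller (x∈p⇒∣p-x∣<∣p∣ y∈U)) covered′
          (¬Any⇒All¬ (x ∷ rest) fresh ∷ uniq) (R-sym xRy , walk) y∈S
        where
        fresh : y ∉ˡ x ∷ rest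
        fresh = non-backtracking-step-is-fresh uniq walk xRy y≢prev
        y∈U : y ∈ U
        y∈U = decidable-stable (y ∈? U) (fresh ∘ covered)
        covered′ : ∀ {v} → v ∉ U - y → v ∈ˡ y ∷ x ∷ rest
        covered′ {v} v∉U-y with v ≟ y
        ... | yes v≡y = here v≡y
        ... | no  v≢y = there (covered (λ v∈U → v∉U-y (x∈p∧x≢y⇒x∈p-y v∈U v≢y)))

    leaf : ∀ {S x} → x ∈ S → ∃ λ ℓ → ℓ ∈ S × AtMostOneNeighbourIn S ℓ
    leaf {x = x} = walk-to-leaf x [] ⊤ (<-wellFounded ∣ ⊤ {n} ∣) (λ v∉⊤ → contradiction ∈⊤ v∉⊤) (All.[] ∷ []) tt

    Orients : Subset n → (Fin n → Maybe (Fin n)) → Set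
    Orients S parent = ∀ {u v} → u ∈ S → v ∈ S → R u v → parent u ≡ just v ⊎ parent v ≡ just u

    private
      orient-subset : ∀ S → Acc _<_ ∣ S ∣ → ∃ (Orients S)
      orient-subset S (acc smaller) with nonempty? S
      ... | no empty = (λ _ → nothing) , λ u∈S _ _ → contradiction (_ , u∈S) empty
      ... | yes (_ , x₀∈S) with leaf x₀∈S
      ... | x , x∈S , m , m-is-neighbour = parent , orients
        where
        rest : ∃ (Orients (S - x))
        rest = orient-subset (S - x) (smaller (x∈p⇒∣p-x∣<∣p∣ x∈S))
        parent′ : Fin n → Maybe (Fin n)
        parent′ = proj₁ rest
        parent : Fin n → Maybe (Fin n)
        parent = updateAt parent′ x (const m)
        orients : Orients S parent
        orients {u} {v} u∈S v∈S uRv with u ≟ x | v ≟ x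
        ... | yes refl | _        = inj₁ (trans (updateAt-updates x parent′) (m-is-neighbour v∈S uRv))
        ... | no _     | yes refl = inj₂ (trans (updateAt-updates x parent′) (m-is-neighbour u∈S (R-sym uRv)))
        ... | no u≢x   | no v≢x   =
          Sum.map (trans (updateAt-minimal u x parent′ u≢x)) (trans (updateAt-minimal v x parent′ v≢x))
            (proj₂ rest (x∈p∧x≢y⇒x∈p-y u∈S u≢x) (x∈p∧x≢y⇒x∈p-y v∈S v≢x) uRv)

    orientation : ∃ λ parent → ∀ {u v} → R u v → parent u ≡ just v ⊎ parent v ≡ just u
    orientation with parent , orients ← orient-subset ⊤ (<-wellFounded ∣ ⊤ {n} ∣) = parent , orients ∈⊤ ∈⊤

  sum-𝟙≡just≤1 : ∀ {n} (m : Maybe (Fin n)) → sum (λ v → 𝟙 (does (≡-dec _≟_ m (just v)))) ≤ 1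
  sum-𝟙≡just≤1 {zero}  m              = z≤n
  sum-𝟙≡just≤1 {suc n} nothing        = sum-𝟙≡just≤1 {n} nothing
  sum-𝟙≡just≤1 {suc n} (just zero)    = s≤s (≤-reflexive (sum-replicate-zero n))
  sum-𝟙≡just≤1 {suc n} (just (suc w)) = sum-𝟙≡just≤1 (just w)

  sum-const : ∀ n c → sum {n} (λ _ → c) ≡ n * c
  sum-const zero    c = refl
  sum-const (suc n) c = cong (c +_) (sum-const n c)

  -- arcs u v counts the arcs u → v, with multiplicity.
  record Orientation (G : Graph) (α : ℕ) : Set where
    open Graph G using (n; adj)
    field
      arcs         : Fin n → Fin n → ℕ
      outdegree≤   : ∀ u → sum (arcs u) ≤ α
      covers-edges : ∀ u v → T (adj u v) → 1 ≤ arcs u v + arcs v u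

  forests⇒orientation : ∀ {G α} → ForestPartition G α → Orientation G α
  forests⇒orientation {G} {α} (P , acyclic) = record
    { arcs         = arcs
    ; outdegree≤   = outdegree≤
    ; covers-edges = covers-edges
    }
    where
    open Graph G using (n; adj; irrefl)
    open EdgePartition P using (colour; colourSym)

    class-edge? : ∀ i u v → Dec (ClassEdge P i u v)
    class-edge? i u v = T? (adj u v) ×-dec (colour u v ≟ i)

    class-edge-sym : ∀ {i u v} → ClassEdge P i u v → ClassEdge P i v u
    class-edge-sym {u = u} {v} (uv , colour≡i) =
      subst T (Graph.sym G u v) uv , trans (sym (colourSym u v uv)) colour≡i

    class-edge-irrefl : ∀ {i u} → ¬ ClassEdge P i u u
    class-edge-irrefl {u = u} (uu , _) = subst T (irrefl u) uu

    module Forest (i : Fin α) = ForestOrientation (class-edge? i) class-edge-sym class-edge-irrefl (acyclic i)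

    parent : Fin α → Fin n → Maybe (Fin n)
    parent i = proj₁ (Forest.orientation i)

    arc : Fin n → Fin n → Fin α → ℕ
    arc u v i = 𝟙 (does (≡-dec _≟_ (parent i u) (just v)))

    arcs : Fin n → Fin n → ℕ
    arcs u v = sum (arc u v)

    outdegree≤ : ∀ u → sum (arcs u) ≤ α
    outdegree≤ u = begin
      sum (λ v → sum (arc u v)) ≡⟨ ∑-comm (arc u) ⟩
      sum (λ i → sum (λ v → arc u v i)) ≤⟨ sum-mono-≤ (λ i → sum-𝟙≡just≤1 (parent i u)) ⟩
      sum {α} (λ _ → 1) ≡⟨ trans (sum-const α 1) (*-identityʳ α) ⟩
      α ∎
      where open ≤-Reasoning

    arc≡1 : ∀ {u v} i → parent i u ≡ just v → arc u v i ≡ 1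
    arc≡1 {u} {v} i u→v = cong 𝟙 (dec-true (≡-dec _≟_ (parent i u) (just v)) u→v)

    covers-edges : ∀ u v → T (adj u v) → 1 ≤ arcs u v + arcs v u
    covers-edges u v uv with proj₂ (Forest.orientation (colour u v)) (uv , refl)
    ... | inj₁ u→v = ≤-trans (≤-trans (≤-reflexive (sym (arc≡1 _ u→v))) (term≤sum (arc u v) _)) (m≤m+n _ _)
    ... | inj₂ v→u = ≤-trans (≤-trans (≤-reflexive (sym (arc≡1 _ v→u))) (term≤sum (arc v u) _)) (m≤n+m _ _)

  -- The nesting is that of the triangle and lightness tests in Defs, so that they agree definitionally.
  onEdges : ∀ {n} → (Bool → Bool → Bool) → (Fin n → Fin n → Bool) → Fin n → Fin n → Fin n → Bool
  onEdges _⊕_ e x y z = e x y ⊕ (e y z ⊕ e x z)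

  module _ {n} {_⊕_ : Bool → Bool → Bool} (⊕-comm : Commutative _⊕_) (⊕-assoc : Associative _⊕_)
           {e : Fin n → Fin n → Bool} (e-sym : ∀ u v → e u v ≡ e v u) where

    onEdges-swap₁₂ : ∀ x y z → onEdges _⊕_ e x y z ≡ onEdges _⊕_ e y x z
    onEdges-swap₁₂ x y z = cong₂ _⊕_ (e-sym x y) (⊕-comm (e y z) (e x z))

    onEdges-swap₂₃ : ∀ x y z → onEdges _⊕_ e x y z ≡ onEdges _⊕_ e x z y
    onEdges-swap₂₃ x y z = begin
      e x y ⊕ (e y z ⊕ e x z) ≡⟨ ⊕-comm (e x y) _ ⟩
      (e y z ⊕ e x z) ⊕ e x y ≡⟨ cong (_⊕ e x y) (⊕-comm (e y z) (e x z)) ⟩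
      (e x z ⊕ e y z) ⊕ e x y ≡⟨ ⊕-assoc (e x z) (e y z) (e x y) ⟩
      e x z ⊕ (e y z ⊕ e x y) ≡⟨ cong (λ b → e x z ⊕ (b ⊕ e x y)) (e-sym y z) ⟩
      e x z ⊕ (e z y ⊕ e x y) ∎
      where open ≡-Reasoning

  ∑³-𝟙-symmetric : ∀ {n} (P : Fin n → Fin n → Fin n → Bool) →
    (∀ x y z → P x y z ≡ P y x z) → (∀ x y z → P x y z ≡ P x z y) → (∀ x z → P x x z ≡ false) →
    ∑³ (λ x y z → 𝟙 (P x y z)) ≡ 6 * ∑³ (λ x y z → 𝟙 (ascendingᶠ x y z ∧ P x y z))
  ∑³-𝟙-symmetric P P-swap₁₂ P-swap₂₃ P-diagonal =
    trans (∑³-symmetric (λ x y z → 𝟙 (P x y z)) (λ x y z → cong 𝟙 (P-swap₁₂ x y z))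
                        (λ x y z → cong 𝟙 (P-swap₂₃ x y z)) (λ x z → cong 𝟙 (P-diagonal x z)))
          (cong (6 *_) (∑³-cong λ x y z → sym (𝟙-∧ (ascendingᶠ x y z) (P x y z))))

  module Triangles (G : Graph) where
    open Graph G using (n; adj; irrefl)

    isTriangle : Fin n → Fin n → Fin n → Bool
    isTriangle = onEdges _∧_ adj

    triCount≡sum : ∀ u v → triCount G u v ≡ sum (λ w → 𝟙 (adj u w ∧ adj v w))
    triCount≡sum u v = count-tabulate (λ w → adj u w ∧ adj v w) id

    triCount-sym : ∀ u v → triCount G u v ≡ triCount G v u
    triCount-sym u v = trans (triCount≡sum u v)
      (trans (sum-cong-≗ λ w → cong 𝟙 (∧-comm (adj u w) (adj v w))) (sym (triCount≡sum v u)))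

    ∑³-triangles≡∑-edges-triCount :
      ∑³ (λ x y z → 𝟙 (isTriangle x y z)) ≡ sum (λ x → sum (λ y → 𝟙 (adj x y) * triCount G x y))
    ∑³-triangles≡∑-edges-triCount = sum-cong-≗ λ x → sum-cong-≗ λ y → begin
      sum (λ z → 𝟙 (adj x y ∧ (adj y z ∧ adj x z)))
        ≡⟨ sum-cong-≗ (λ z → trans (cong (λ b → 𝟙 (adj x y ∧ b)) (∧-comm (adj y z) (adj x z))) (𝟙-∧ (adj x y) _)) ⟩
      sum (λ z → 𝟙 (adj x y) * 𝟙 (adj x z ∧ adj y z))
        ≡⟨ sym (*-distribˡ-sum (𝟙 (adj x y)) (λ z → 𝟙 (adj x z ∧ adj y z))) ⟩
      𝟙 (adj x y) * sum (λ z → 𝟙 (adj x z ∧ adj y z))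
        ≡⟨ cong (𝟙 (adj x y) *_) (sym (triCount≡sum x y)) ⟩
      𝟙 (adj x y) * triCount G x y ∎
      where open ≡-Reasoning

    isTriangle-swap₁₂ : ∀ x y z → isTriangle x y z ≡ isTriangle y x z
    isTriangle-swap₁₂ = onEdges-swap₁₂ ∧-comm ∧-assoc (Graph.sym G)

    isTriangle-swap₂₃ : ∀ x y z → isTriangle x y z ≡ isTriangle x z y
    isTriangle-swap₂₃ = onEdges-swap₂₃ ∧-comm ∧-assoc (Graph.sym G)

    isTriangle-diagonal : ∀ x z → isTriangle x x z ≡ false
    isTriangle-diagonal x z = cong (_∧ (adj x z ∧ adj x z)) (irrefl x)

    -- The filter of Defs.triangles, so that triangles G reduces to filterᵇ ascendingTriangle (triples n).
    ascendingTriangle : Fin n × Fin n × Fin n → Bool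
    ascendingTriangle (x , y , z) = (toℕ x <ᵇ toℕ y) ∧ (toℕ y <ᵇ toℕ z) ∧ isTriangle x y z

    ascendingTriangle≡ : ∀ x y z → ascendingTriangle (x , y , z) ≡ ascendingᶠ x y z ∧ isTriangle x y z
    ascendingTriangle≡ x y z = sym (∧-assoc (toℕ x <ᵇ toℕ y) (toℕ y <ᵇ toℕ z) (isTriangle x y z))

    6*#triangles≡∑³ : 6 * length (triangles G) ≡ ∑³ (λ x y z → 𝟙 (isTriangle x y z))
    6*#triangles≡∑³ = begin
      6 * count ascendingTriangle (triples n)
        ≡⟨ cong (6 *_) (count-triples ascendingTriangle) ⟩
      6 * ∑³ (λ x y z → 𝟙 (ascendingTriangle (x , y , z)))
        ≡⟨ cong (6 *_) (∑³-cong λ x y z → cong 𝟙 (ascendingTriangle≡ x y z)) ⟩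
      6 * ∑³ (λ x y z → 𝟙 (ascendingᶠ x y z ∧ isTriangle x y z))
        ≡⟨ sym (∑³-𝟙-symmetric isTriangle isTriangle-swap₁₂ isTriangle-swap₂₃ isTriangle-diagonal) ⟩
      ∑³ (λ x y z → 𝟙 (isTriangle x y z)) ∎
      where open ≡-Reasoning

    module _ (light : Fin n → Fin n → Bool) where

      isLightTriangle : Fin n → Fin n → Fin n → Bool
      isLightTriangle = onEdges _∨_ light

      isLight : Fin n × Fin n × Fin n → Bool
      isLight (x , y , z) = isLightTriangle x y z

      isHeavyTriangle : Fin n → Fin n → Fin n → Bool
      isHeavyTriangle x y z = isTriangle x y z ∧ not (isLightTriangle x y z)

      #heavyTriangles : ℕ
      #heavyTriangles = count (not ∘ isLight) (triangles G)

      #light+#heavy≡#triangles : count isLight (triangles G) + #heavyTriangles ≡ length (triangles G)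
      #light+#heavy≡#triangles = count+count-not isLight (triangles G)

      module _ (light-sym : ∀ u v → light u v ≡ light v u) where

        isHeavyTriangle-swap₁₂ : ∀ x y z → isHeavyTriangle x y z ≡ isHeavyTriangle y x z
        isHeavyTriangle-swap₁₂ x y z =
          cong₂ (λ t l → t ∧ not l) (isTriangle-swap₁₂ x y z) (onEdges-swap₁₂ ∨-comm ∨-assoc light-sym x y z)

        isHeavyTriangle-swap₂₃ : ∀ x y z → isHeavyTriangle x y z ≡ isHeavyTriangle x z y
        isHeavyTriangle-swap₂₃ x y z =
          cong₂ (λ t l → t ∧ not l) (isTriangle-swap₂₃ x y z) (onEdges-swap₂₃ ∨-comm ∨-assoc light-sym x y z)

        isHeavyTriangle-diagonal : ∀ x z → isHeavyTriangle x x z ≡ false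
        isHeavyTriangle-diagonal x z = cong (λ t → t ∧ not (isLightTriangle x x z)) (isTriangle-diagonal x z)

        6*#heavy≡∑³ : 6 * #heavyTriangles ≡ ∑³ (λ x y z → 𝟙 (isHeavyTriangle x y z))
        6*#heavy≡∑³ = begin
          6 * count (not ∘ isLight) (filterᵇ ascendingTriangle (triples n))
            ≡⟨ cong (6 *_) (count-filterᵇ ascendingTriangle (not ∘ isLight) (triples n)) ⟩
          6 * count (λ t → ascendingTriangle t ∧ not (isLight t)) (triples n)
            ≡⟨ cong (6 *_) (count-triples (λ t → ascendingTriangle t ∧ not (isLight t))) ⟩
          6 * ∑³ (λ x y z → 𝟙 (ascendingTriangle (x , y , z) ∧ not (isLightTriangle x y z)))
            ≡⟨ cong (6 *_) (∑³-cong λ x y z → cong 𝟙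
                 (trans (cong (_∧ not (isLightTriangle x y z)) (ascendingTriangle≡ x y z))
                        (∧-assoc (ascendingᶠ x y z) _ _))) ⟩
          6 * ∑³ (λ x y z → 𝟙 (ascendingᶠ x y z ∧ isHeavyTriangle x y z))
            ≡⟨ sym (∑³-𝟙-symmetric isHeavyTriangle
                      isHeavyTriangle-swap₁₂ isHeavyTriangle-swap₂₃ isHeavyTriangle-diagonal) ⟩
          ∑³ (λ x y z → 𝟙 (isHeavyTriangle x y z)) ∎
          where open ≡-Reasoning

        module _ {α} (O : Orientation G α) {p q : ℕ}
                 (heavy-edge : ∀ u v → ¬ T (light u v) → p ≤ q * triCount G u v) where
          open Orientation O

          heavy-edges : ∀ {x y z} → T (isHeavyTriangle x y z) → T (adj x y) × T (adj x z) × p ≤ q * triCount G x z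
          heavy-edges {x} {y} {z} heavy = xy , xz , heavy-edge x z xz-not-light
            where
            triangle : T (isTriangle x y z)
            triangle = proj₁ (Equivalence.to (T-∧ {isTriangle x y z}) heavy)
            not-light : isLightTriangle x y z ≡ false
            not-light = Equivalence.to T-not-≡ (proj₂ (Equivalence.to (T-∧ {isTriangle x y z}) heavy))
            xy : T (adj x y)
            xy = proj₁ (Equivalence.to (T-∧ {adj x y}) triangle)
            xz : T (adj x z)
            xz = proj₂ (Equivalence.to (T-∧ {adj y z}) (proj₂ (Equivalence.to (T-∧ {adj x y}) triangle)))
            xz-not-light : ¬ T (light x z)
            xz-not-light xz-light = subst T not-light
              (Equivalence.from (T-∨ {light x y}) (inj₂ (Equivalence.from (T-∨ {light y z}) (inj₂ xz-light))))

          H : Fin n → Fin n → Fin n → ℕ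
          H x y z = 𝟙 (isHeavyTriangle x y z)

          heavy≤arcs : ∑³ H ≤ 2 * ∑³ (λ x y z → H x y z * arcs x y)
          heavy≤arcs = begin
            ∑³ H
              ≤⟨ ∑³-mono-≤ (λ x y z → 𝟙≤𝟙* (isHeavyTriangle x y z) λ heavy →
                   covers-edges x y (proj₁ (heavy-edges heavy))) ⟩
            ∑³ (λ x y z → H x y z * (arcs x y + arcs y x))
              ≡⟨ ∑³-cong (λ x y z → *-distribˡ-+ (H x y z) (arcs x y) (arcs y x)) ⟩
            ∑³ (λ x y z → H x y z * arcs x y + H x y z * arcs y x)
              ≡⟨ ∑³-distrib-+ (λ x y z → H x y z * arcs x y) (λ x y z → H x y z * arcs y x) ⟩
            X + ∑³ (λ x y z → H x y z * arcs y x)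
              ≡⟨ cong (X +_) (trans (∑³-swap₁₂ (λ x y z → H x y z * arcs y x)) (∑³-cong λ x y z →
                   cong (λ b → 𝟙 b * arcs x y) (sym (isHeavyTriangle-swap₁₂ x y z)))) ⟩
            X + X
              ≡⟨ cong (X +_) (sym (+-identityʳ X)) ⟩
            2 * X ∎
            where
            open ≤-Reasoning
            X : ℕ
            X = ∑³ (λ x y z → H x y z * arcs x y)

          arcs-into-heavy-edge : ∀ x y → p * sum (λ z → H x z y * arcs x z) ≤ α * q * (𝟙 (adj x y) * triCount G x y)
          arcs-into-heavy-edge x y = begin
            p * sum (λ z → H x z y * arcs x z)
              ≡⟨ *-distribˡ-sum p (λ z → H x z y * arcs x z) ⟩
            sum (λ z → p * (H x z y * arcs x z))
              ≤⟨ sum-mono-≤ (λ z → 𝟙-weighted-≤ (isHeavyTriangle x z y) (arcs x z) p≤weight) ⟩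
            sum (λ z → (q * triCount G x y * 𝟙 (adj x y)) * arcs x z)
              ≡⟨ sym (*-distribˡ-sum (q * triCount G x y * 𝟙 (adj x y)) (arcs x)) ⟩
            (q * triCount G x y * 𝟙 (adj x y)) * sum (arcs x)
              ≤⟨ *-monoʳ-≤ (q * triCount G x y * 𝟙 (adj x y)) (outdegree≤ x) ⟩
            (q * triCount G x y * 𝟙 (adj x y)) * α
              ≡⟨ rearrange q (triCount G x y) (𝟙 (adj x y)) α ⟩
            α * q * (𝟙 (adj x y) * triCount G x y) ∎
            where
            open ≤-Reasoning
            rearrange : ∀ q t a α → q * t * a * α ≡ α * q * (a * t)
            rearrange = solve-∀
            p≤weight : ∀ {z} → T (isHeavyTriangle x z y) → p ≤ q * triCount G x y * 𝟙 (adj x y)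
            p≤weight heavy with _ , xy , p≤ ← heavy-edges heavy =
              subst (p ≤_) (sym (trans (cong (q * triCount G x y *_) (𝟙-T xy)) (*-identityʳ _))) p≤

          heavy-arcs≤ : p * ∑³ (λ x y z → H x y z * arcs x y) ≤ α * q * ∑³ (λ x y z → 𝟙 (isTriangle x y z))
          heavy-arcs≤ = begin
            p * ∑³ (λ x y z → H x y z * arcs x y)
              ≡⟨ cong (p *_) (∑³-swap₂₃ (λ x y z → H x y z * arcs x y)) ⟩
            p * sum (λ x → sum (λ y → sum (λ z → H x z y * arcs x z)))
              ≡⟨ *-distribˡ-sum² p (λ x y → sum (λ z → H x z y * arcs x z)) ⟩
            sum (λ x → sum (λ y → p * sum (λ z → H x z y * arcs x z)))
              ≤⟨ sum-mono-≤ (λ x → sum-mono-≤ (arcs-into-heavy-edge x)) ⟩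
            sum (λ x → sum (λ y → α * q * (𝟙 (adj x y) * triCount G x y)))
              ≡⟨ sym (*-distribˡ-sum² (α * q) (λ x y → 𝟙 (adj x y) * triCount G x y)) ⟩
            α * q * sum (λ x → sum (λ y → 𝟙 (adj x y) * triCount G x y))
              ≡⟨ cong (α * q *_) (sym ∑³-triangles≡∑-edges-triCount) ⟩
            α * q * ∑³ (λ x y z → 𝟙 (isTriangle x y z)) ∎
            where open ≤-Reasoning

          heavyTriangles-bound : p * #heavyTriangles ≤ 2 * α * (q * length (triangles G))
          heavyTriangles-bound = *-cancelˡ-≤ 6 (begin
            6 * (p * #heavyTriangles)               ≡⟨ rearrange₁ p #heavyTriangles ⟩
            p * (6 * #heavyTriangles)               ≡⟨ cong (p *_) 6*#heavy≡∑³ ⟩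
            p * ∑³ H                                ≤⟨ *-monoʳ-≤ p heavy≤arcs ⟩
            p * (2 * X)                             ≡⟨ rearrange₂ p X ⟩
            2 * (p * X)                             ≤⟨ *-monoʳ-≤ 2 heavy-arcs≤ ⟩
            2 * (α * q * ∑³ (λ x y z → 𝟙 (isTriangle x y z))) ≡⟨ cong (λ t → 2 * (α * q * t)) (sym 6*#triangles≡∑³) ⟩
            2 * (α * q * (6 * #all))                ≡⟨ rearrange₃ α q #all ⟩
            6 * (2 * α * (q * #all))                ∎)
            where
            open ≤-Reasoning
            #all : ℕ
            #all = length (triangles G)
            X : ℕ
            X = ∑³ (λ x y z → H x y z * arcs x y)
            rearrange₁ : ∀ p h → 6 * (p * h) ≡ p * (6 * h)
            rearrange₁ = solve-∀
            rearrange₂ : ∀ p x → p * (2 * x) ≡ 2 * (p * x)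
            rearrange₂ = solve-∀
            rearrange₃ : ∀ α q t → 2 * (α * q * (6 * t)) ≡ 6 * (2 * α * (q * t))
            rearrange₃ = solve-∀

open Combinatorics using (forests⇒orientation; module Triangles)
open import Data.List using (length)
open import Data.Fin using (Fin)

open import Data.Bool using (Bool; T)
open import Data.Nat using (ℕ; suc)
import Data.Nat as ℕ
import Data.Nat.Properties as ℕ
open import Data.Nat.Coprimality using (Coprime; 1-coprimeTo)
import Data.Nat.Coprimality as Coprime
open import Data.Integer using (+_; +[1+_])
import Data.Integer as ℤ
import Data.Integer.Properties as ℤ
open import Data.Rational
  using (ℚ; mkℚ; _/_; _≤_; _<_; _+_; _-_; _*_; _÷_; 1/_; 1ℚ; _≤ᵇ_; *≤*; toℚᵘ; Positive; NonNegative; NonZero)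
open import Data.Rational.Properties
  using ( normalize-coprime; toℚᵘ-injective; toℚᵘ-homo-+; toℚᵘ-homo-*; pos⇒nonZero; pos⇒nonNeg; 1/pos⇒pos
        ; *-assoc; *-inverseʳ; *-identityʳ; *-monoʳ-≤-nonNeg; *-cancelʳ-≤-pos; +-monoʳ-≤
        ; ≤⇒≤ᵇ; ≰⇒>; drop-*<*; module ≤-Reasoning)
open import Data.Rational.Solver using (module +-*-Solver)
open import Data.Rational.Unnormalised using (mkℚᵘ)
import Data.Rational.Unnormalised as ℚᵘ
import Data.Rational.Unnormalised.Properties as ℚᵘ
open import Data.Product using (_,_)
open import Function using (_∘_)
open import Relation.Nullary using (¬_)
open import Relation.Binary.PropositionalEquality
  using (_≡_; refl; sym; trans; cong; cong₂; subst; subst₂; module ≡-Reasoning)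

ι : ℕ → ℚ
ι m = + m / 1

ι≡mkℚ : ∀ m → ι m ≡ mkℚ (+ m) 0 (Coprime.sym (1-coprimeTo m))
ι≡mkℚ m = normalize-coprime (Coprime.sym (1-coprimeTo m))

toℚᵘ-ι : ∀ m → toℚᵘ (ι m) ≡ mkℚᵘ (+ m) 0
toℚᵘ-ι m = cong toℚᵘ (ι≡mkℚ m)

ι-+ : ∀ m n → ι (m ℕ.+ n) ≡ ι m + ι n
ι-+ m n = toℚᵘ-injective (ℚᵘ.≃-trans (ℚᵘ.≃-reflexive (begin
  toℚᵘ (ι (m ℕ.+ n))                     ≡⟨ toℚᵘ-ι (m ℕ.+ n) ⟩
  mkℚᵘ (+ (m ℕ.+ n)) 0                   ≡⟨ cong (λ i → mkℚᵘ i 0) (ℤ.pos-+ m n) ⟩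
  mkℚᵘ (+ m ℤ.+ + n) 0                   ≡⟨ cong (λ i → mkℚᵘ i 0)
                                               (sym (cong₂ ℤ._+_ (ℤ.*-identityʳ (+ m)) (ℤ.*-identityʳ (+ n)))) ⟩
  mkℚᵘ (+ m) 0 ℚᵘ.+ mkℚᵘ (+ n) 0         ≡⟨ sym (cong₂ ℚᵘ._+_ (toℚᵘ-ι m) (toℚᵘ-ι n)) ⟩
  toℚᵘ (ι m) ℚᵘ.+ toℚᵘ (ι n)             ∎))
  (ℚᵘ.≃-sym (toℚᵘ-homo-+ (ι m) (ι n))))
  where open ≡-Reasoning

ι-* : ∀ m n → ι (m ℕ.* n) ≡ ι m * ι n
ι-* m n = toℚᵘ-injective (ℚᵘ.≃-trans (ℚᵘ.≃-reflexive (begin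
  toℚᵘ (ι (m ℕ.* n))                     ≡⟨ toℚᵘ-ι (m ℕ.* n) ⟩
  mkℚᵘ (+ (m ℕ.* n)) 0                   ≡⟨ cong (λ i → mkℚᵘ i 0) (ℤ.pos-* m n) ⟩
  mkℚᵘ (+ m) 0 ℚᵘ.* mkℚᵘ (+ n) 0         ≡⟨ sym (cong₂ ℚᵘ._*_ (toℚᵘ-ι m) (toℚᵘ-ι n)) ⟩
  toℚᵘ (ι m) ℚᵘ.* toℚᵘ (ι n)             ∎))
  (ℚᵘ.≃-sym (toℚᵘ-homo-* (ι m) (ι n))))
  where open ≡-Reasoning

ι-mono-≤ : ∀ {m n} → m ℕ.≤ n → ι m ≤ ι n
ι-mono-≤ {m} {n} m≤n rewrite ι≡mkℚ m | ι≡mkℚ n = *≤* (ℤ.*-monoʳ-≤-nonNeg (+ 1) (ℤ.+≤+ m≤n))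

mkℚ*denominator : ∀ {k d} .(c : Coprime (suc k) (suc d)) → mkℚ +[1+ k ] d c * ι (suc d) ≡ ι (suc k)
mkℚ*denominator {k} {d} c = toℚᵘ-injective (ℚᵘ.≃-trans (toℚᵘ-homo-* (mkℚ +[1+ k ] d c) (ι (suc d)))
  (ℚᵘ.≃-trans (ℚᵘ.≃-reflexive (cong (mkℚᵘ +[1+ k ] d ℚᵘ.*_) (toℚᵘ-ι (suc d))))
  (ℚᵘ.≃-trans (ℚᵘ.*≡* (trans (ℤ.*-identityʳ _) (cong (λ m → +[1+ k ] ℤ.* + suc m) (sym (ℕ.*-identityʳ d)))))
  (ℚᵘ.≃-reflexive (sym (toℚᵘ-ι (suc k)))))))

ι-positive : ∀ m → Positive (ι (suc m))
ι-positive m = subst Positive (sym (ι≡mkℚ (suc m))) _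

ι*mkℚ≤ : ∀ {h a t k d} .(c : Coprime (suc k) (suc d)) →
  suc k ℕ.* h ℕ.≤ a ℕ.* (suc d ℕ.* t) → ι h * mkℚ +[1+ k ] d c ≤ ι a * ι t
ι*mkℚ≤ {h} {a} {t} {k} {d} c pH≤aqT = *-cancelʳ-≤-pos (ι (suc d)) {{ι-positive d}} (begin
  ι h * τ * ι (suc d)          ≡⟨ *-assoc (ι h) τ (ι (suc d)) ⟩
  ι h * (τ * ι (suc d))        ≡⟨ cong (ι h *_) (mkℚ*denominator c) ⟩
  ι h * ι (suc k)              ≡⟨ sym (trans (cong ι (ℕ.*-comm (suc k) h)) (ι-* h (suc k))) ⟩
  ι (suc k ℕ.* h)              ≤⟨ ι-mono-≤ pH≤aqT ⟩
  ι (a ℕ.* (suc d ℕ.* t))      ≡⟨ trans (ι-* a _) (cong (ι a *_) (ι-* (suc d) t)) ⟩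
  ι a * (ι (suc d) * ι t)      ≡⟨ solve 3 (λ a q t → a :* (q :* t) := a :* t :* q) refl (ι a) (ι (suc d)) (ι t) ⟩
  ι a * ι t * ι (suc d)        ∎)
  where
  open ≤-Reasoning
  open +-*-Solver
  τ : ℚ
  τ = mkℚ +[1+ k ] d c

≰mkℚ⇒< : ∀ {k d} .(c : Coprime (suc k) (suc d)) t → ¬ T (ι t ≤ᵇ mkℚ +[1+ k ] d c) → suc k ℕ.< suc d ℕ.* t
≰mkℚ⇒< {k} {d} c t ιt≰τ = subst (suc k ℕ.<_) (ℕ.*-comm t (suc d)) (ℤ.drop‿+<+ (subst₂ ℤ._<_
  (ℤ.*-identityʳ (+ suc k)) (sym (ℤ.pos-* t (suc d)))
  (drop-*<* (subst (mkℚ +[1+ k ] d c <_) (ι≡mkℚ t) (≰⇒> (ιt≰τ ∘ ≤⇒≤ᵇ))))))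

proportion-bound : ∀ {t l h a} τ .{{_ : Positive τ}} → t ≡ l + h → h * τ ≤ a * t →
  (1ℚ - _÷_ a τ {{pos⇒nonZero τ}}) * t ≤ l
proportion-bound {_} {l} {h} {a} τ refl hτ≤at = begin
  (1ℚ - r) * (l + h)
    ≡⟨ solve 3 (λ r l h → (con 1ℚ :- r) :* (l :+ h) := (l :- r :* (l :+ h)) :+ h) refl r l h ⟩
  (l - r * (l + h)) + h
    ≤⟨ +-monoʳ-≤ (l - r * (l + h)) h≤r[l+h] ⟩
  (l - r * (l + h)) + r * (l + h)
    ≡⟨ solve 2 (λ l x → (l :- x) :+ x := l) refl l (r * (l + h)) ⟩
  l ∎
  where
  open ≤-Reasoning
  open +-*-Solver
  instance
    τ≢0 : NonZero τ
    τ≢0 = pos⇒nonZero τ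
    1/τ≥0 : NonNegative (1/ τ)
    1/τ≥0 = pos⇒nonNeg (1/ τ) {{1/pos⇒pos τ}}
  r : ℚ
  r = a ÷ τ
  h≤r[l+h] : h ≤ r * (l + h)
  h≤r[l+h] = subst₂ _≤_
    (trans (*-assoc h τ (1/ τ)) (trans (cong (h *_) (*-inverseʳ τ)) (*-identityʳ h)))
    (solve 3 (λ a t s → a :* t :* s := a :* s :* t) refl a (l + h) (1/ τ))
    (*-monoʳ-≤-nonNeg (1/ τ) hτ≤at)

mainTheorem3 : (G : Graph) (α : ℕ) → IsArboricity G α →
    (τ : ℚ) → .{{_ : Positive τ}} →
    (1ℚ - _÷_ ((+ (3 Data.Nat.* α)) / 1) τ {{pos⇒nonZero τ}}) * ((+ length (triangles G)) / 1)
      ≤ (+ length (lightTriangles G τ)) / 1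
mainTheorem3 G α (forests , _) τ@(mkℚ +[1+ k ] d c) =
  proportion-bound {a = ι (3 ℕ.* α)} τ #all≡#light+#heavy heavy-ratio
  where
  open Triangles G
  light : Fin (Graph.n G) → Fin (Graph.n G) → Bool
  light = lightEdge G τ
  light-sym : ∀ u v → light u v ≡ light v u
  light-sym u v = cong (λ t → ι t ≤ᵇ τ) (triCount-sym u v)
  #all #heavy : ℕ
  #all = length (triangles G)
  #heavy = #heavyTriangles light
  #all≡#light+#heavy : ι #all ≡ ι (length (lightTriangles G τ)) + ι #heavy
  #all≡#light+#heavy =
    trans (cong ι (sym (#light+#heavy≡#triangles light))) (ι-+ (length (lightTriangles G τ)) #heavy)
  heavy-bound : suc k ℕ.* #heavy ℕ.≤ 2 ℕ.* α ℕ.* (suc d ℕ.* #all)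
  heavy-bound = heavyTriangles-bound light light-sym (forests⇒orientation forests) {p = suc k} {q = suc d}
    (λ u v → ℕ.<⇒≤ ∘ ≰mkℚ⇒< c (triCount G u v))
  2α≤3α : 2 ℕ.* α ℕ.* (suc d ℕ.* #all) ℕ.≤ 3 ℕ.* α ℕ.* (suc d ℕ.* #all)
  2α≤3α = ℕ.*-monoˡ-≤ (suc d ℕ.* #all) (ℕ.*-monoˡ-≤ α (ℕ.s≤s (ℕ.s≤s (ℕ.z≤n {1}))))
  heavy-ratio : ι #heavy * τ ≤ ι (3 ℕ.* α) * ι #all
  heavy-ratio = ι*mkℚ≤ {a = 3 ℕ.* α} {t = #all} c (ℕ.≤-trans heavy-bound 2α≤3α)
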